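{- The theta graph $\theta_{3,3,4}$ is an $i$-graph.
   Context: For a graph $G$, an $i$-set is an independent dominating set of minimum cardinality. The $i$-graph $\mathcal{I}(G)$ has the $i$-sets as vertices, with $X\sim Y$ iff $Y=(X\setminus\{u\})\cup\{v\}$ for some $u\in X$, $v\notin X$ with $uv\in E(G)$; $H$ is an $i$-graph if $H\cong\mathcal{I}(G)$ for some graph $G$. $\theta_{j,k,\ell}$ denotes two vertices joined by three internally vertex-disjoint paths of lengths $j,k,\ell$. -}

module Defs where

open import Data.Nat using (ℕ; _≤_)
open import Data.Bool using (Bool; true; false; _∨_; _∧_)
open import Data.Fin using (Fin; zero; suc; _≟_)
open import Data.Fin.Patterns
open import Data.Fin.Subset using (Subset; _∈_; _∉_; ∣_∣; ⁅_⁆; _∪_; _-_)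
open import Data.Product using (Σ; ∃; ∃-syntax; _×_; _,_)
open import Data.Sum using (_⊎_)
open import Data.List using (List; []; _∷_)
open import Relation.Nullary.Decidable using (⌊_⌋)
open import Relation.Binary.PropositionalEquality using (_≡_; refl)
open import Function.Bundles using (_⇔_)

record Graph : Set where
  field
    n     : ℕ
    Adj   : Fin n → Fin n → Bool
    sym   : ∀ u v → Adj u v ≡ Adj v u
    irrefl : ∀ u → Adj u u ≡ false
open Graph public

module _ (G : Graph) where
  private V = Fin (n G)

  Independent : Subset (n G) → Set
  Independent S = ∀ u v → u ∈ S → v ∈ S → Adj G u v ≡ false

  Dominating : Subset (n G) → Set
  Dominating S = ∀ v → v ∈ S ⊎ (∃[ u ] (u ∈ S × Adj G u v ≡ true))

  IndependentDominating : Subset (n G) → Set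
  IndependentDominating S = Independent S × Dominating S

  IsISet : Subset (n G) → Set
  IsISet S = IndependentDominating S ×
             (∀ T → IndependentDominating T → ∣ S ∣ ≤ ∣ T ∣)

  ISetJump : Subset (n G) → Subset (n G) → Set
  ISetJump X Y = ∃[ u ] ∃[ v ] (u ∈ X × v ∉ X × Adj G u v ≡ true ×
                                 Y ≡ (X - u) ∪ ⁅ v ⁆)

IsoToIGraph : Graph → Graph → Set
IsoToIGraph H G =
  Σ (Fin (n H) → Subset (n G)) λ f →
    (∀ x → IsISet G (f x)) ×
    (∀ x y → f x ≡ f y → x ≡ y) ×
    (∀ S → IsISet G S → ∃[ x ] (f x ≡ S)) ×
    (∀ x y → (Adj H x y ≡ true) ⇔ ISetJump G (f x) (f y))

IsIGraph : Graph → Set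
IsIGraph H = ∃[ G ] IsoToIGraph H G

-- θ_{3,3,4}: end vertices 0 and 1; paths 0-2-3-1, 0-4-5-1 (length 3)
-- and 0-6-7-8-1 (length 4).  9 vertices, 10 edges.
θ334-edges : List (Fin 9 × Fin 9)
θ334-edges =
  (0F , 2F) ∷ (2F , 3F) ∷ (3F , 1F) ∷
  (0F , 4F) ∷ (4F , 5F) ∷ (5F , 1F) ∷
  (0F , 6F) ∷ (6F , 7F) ∷ (7F , 8F) ∷ (8F , 1F) ∷ []

private
  hasEdge : List (Fin 9 × Fin 9) → Fin 9 → Fin 9 → Bool
  hasEdge [] u v = false
  hasEdge ((a , b) ∷ es) u v =
    (⌊ a ≟ u ⌋ ∧ ⌊ b ≟ v ⌋) ∨ (⌊ a ≟ v ⌋ ∧ ⌊ b ≟ u ⌋) ∨ hasEdge es u v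

  ∨-comm : ∀ x y → (x ∨ y) ≡ (y ∨ x)
  ∨-comm false false = refl
  ∨-comm false true = refl
  ∨-comm true false = refl
  ∨-comm true true = refl

  ∨-swap : ∀ x y z → (x ∨ y ∨ z) ≡ (y ∨ x ∨ z)
  ∨-swap false y z = refl
  ∨-swap true false z = refl
  ∨-swap true true z = refl

  hasEdge-sym : ∀ es u v → hasEdge es u v ≡ hasEdge es v u
  hasEdge-sym [] u v = refl
  hasEdge-sym ((a , b) ∷ es) u v
    rewrite hasEdge-sym es u v
    = ∨-swap (⌊ a ≟ u ⌋ ∧ ⌊ b ≟ v ⌋) (⌊ a ≟ v ⌋ ∧ ⌊ b ≟ u ⌋) (hasEdge es v u)

  θ-irrefl : ∀ u → hasEdge θ334-edges u u ≡ false
  θ-irrefl 0F = refl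
  θ-irrefl 1F = refl
  θ-irrefl 2F = refl
  θ-irrefl 3F = refl
  θ-irrefl 4F = refl
  θ-irrefl 5F = refl
  θ-irrefl 6F = refl
  θ-irrefl 7F = refl
  θ-irrefl 8F = refl

θ334 : Graph
θ334 = record
  { n = 9
  ; Adj = hasEdge θ334-edges
  ; sym = hasEdge-sym θ334-edges
  ; irrefl = θ-irrefl
  }

-- The witness is a graph G on nine vertices with sixteen edges whose independent
-- domination number is 3 and which has exactly nine independent dominating sets of
-- size 3; listed in the right order they form the vertices of a copy of θ334 in 𝓘(G).
-- Once one independent dominating set of size k exists and none is smaller, the
-- i-sets are precisely the independent dominating sets of size k, so everything
-- left is a finite check over the 2⁹ subsets of V(G), done by decision procedures.
module Submission where

open import Defs
open import Data.Bool using (Bool; true; false)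
import Data.Bool as Bool
open import Data.Fin using (Fin)
import Data.Fin as Fin
open import Data.Fin.Patterns
open import Data.Fin.Properties using (all?; any?)
open import Data.Fin.Subset using (Subset; ∣_∣; ⁅_⁆; _∪_; _-_)
open import Data.Fin.Subset.Properties using (_∈?_; anySubset?)
open import Data.List using (List; []; _∷_)
open import Data.Nat using (ℕ; _≤_; _≤?_)
import Data.Nat as ℕ
open import Data.Nat.Properties using (≤-antisym)
open import Data.Product using (∃-syntax; _×_; _,_)
open import Data.Vec.Properties using (≡-dec)
open import Function using (_∘_)
open import Function.Bundles using (_⇔_; mk⇔; module Equivalence)
open import Level using (Level)
open import Relation.Binary.PropositionalEquality using (_≡_; subst)
import Relation.Binary.PropositionalEquality as ≡
open import Relation.Nullary using (Dec; ¬?)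
open import Relation.Nullary.Decidable
  using (⌊_⌋; map′; from-yes; decidable-stable; _×-dec_; _⊎-dec_; _→-dec_)
open import Relation.Nullary.Negation using (∀⟶¬∃¬)
open import Relation.Unary using (Pred; Decidable)

private
  variable
    a b ℓ : Level
    A : Set a
    B : Set b
    m : ℕ

allSubset? : {P : Pred (Subset m) ℓ} → Decidable P → Dec (∀ S → P S)
allSubset? P? =
  map′ (λ ∄¬P S → decidable-stable (P? S) (λ ¬PS → ∄¬P (S , ¬PS)))
       ∀⟶¬∃¬
       (¬? (anySubset? (¬? ∘ P?)))

_⇔-dec_ : Dec A → Dec B → Dec (A ⇔ B)
a? ⇔-dec b? =
  map′ (λ (to , from) → mk⇔ to from)
       (λ A⇔B → Equivalence.to A⇔B , Equivalence.from A⇔B)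
       ((a? →-dec b?) ×-dec (b? →-dec a?))

module _ (G : Graph) where

  private
    _~?_ : ∀ u v → Dec (Adj G u v ≡ true)
    u ~? v = Adj G u v Bool.≟ true

  independent? : Decidable (Independent G)
  independent? S = all? λ u → all? λ v →
    (u ∈? S) →-dec ((v ∈? S) →-dec (Adj G u v Bool.≟ false))

  dominating? : Decidable (Dominating G)
  dominating? S = all? λ v → (v ∈? S) ⊎-dec any? (λ u → (u ∈? S) ×-dec (u ~? v))

  independentDominating? : Decidable (IndependentDominating G)
  independentDominating? S = independent? S ×-dec dominating? S

  iSetJump? : ∀ X Y → Dec (ISetJump G X Y)
  iSetJump? X Y = any? λ u → any? λ v →
    (u ∈? X) ×-dec (¬? (v ∈? X) ×-dec
      ((u ~? v) ×-dec ≡-dec Bool._≟_ Y ((X - u) ∪ ⁅ v ⁆)))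

  isISet⇔minimumSize : ∀ {k S₀} →
    IndependentDominating G S₀ → ∣ S₀ ∣ ≡ k →
    (∀ T → IndependentDominating G T → k ≤ ∣ T ∣) →
    ∀ S → IsISet G S ⇔ (IndependentDominating G S × ∣ S ∣ ≡ k)
  isISet⇔minimumSize {k} {S₀} idS₀ ∣S₀∣≡k k≤ S = mk⇔ to from
    where
    to : IsISet G S → IndependentDominating G S × ∣ S ∣ ≡ k
    to (idS , minimum) =
      idS , ≤-antisym (subst (∣ S ∣ ≤_) ∣S₀∣≡k (minimum S₀ idS₀)) (k≤ S idS)

    from : IndependentDominating G S × ∣ S ∣ ≡ k → IsISet G S
    from (idS , ∣S∣≡k) = idS , λ T idT → subst (_≤ ∣ T ∣) (≡.sym ∣S∣≡k) (k≤ T idT)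

edgeAdjacency : List (Fin m × Fin m) → Fin m → Fin m → Bool
edgeAdjacency []             u v = false
edgeAdjacency ((a , b) ∷ es) u v =
  (⌊ a Fin.≟ u ⌋ Bool.∧ ⌊ b Fin.≟ v ⌋) Bool.∨ (⌊ a Fin.≟ v ⌋ Bool.∧ ⌊ b Fin.≟ u ⌋)
    Bool.∨ edgeAdjacency es u v

G-edges : List (Fin 9 × Fin 9)
G-edges =
  (0F , 6F) ∷ (0F , 7F) ∷ (1F , 2F) ∷ (1F , 3F) ∷ (1F , 5F) ∷ (1F , 6F) ∷
  (2F , 3F) ∷ (2F , 4F) ∷ (2F , 5F) ∷ (2F , 7F) ∷ (3F , 4F) ∷ (3F , 6F) ∷
  (3F , 7F) ∷ (4F , 7F) ∷ (4F , 8F) ∷ (6F , 7F) ∷ []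

G : Graph
G = record
  { n      = 9
  ; Adj    = adj
  ; sym    = from-yes (all? λ u → all? λ v → adj u v Bool.≟ adj v u)
  ; irrefl = from-yes (all? λ u → adj u u Bool.≟ false)
  }
  where
  adj : Fin 9 → Fin 9 → Bool
  adj = edgeAdjacency G-edges

iSet : Fin 9 → Subset 9
iSet 0F = ⁅ 0F ⁆ ∪ ⁅ 1F ⁆ ∪ ⁅ 8F ⁆
iSet 1F = ⁅ 5F ⁆ ∪ ⁅ 6F ⁆ ∪ ⁅ 8F ⁆
iSet 2F = ⁅ 0F ⁆ ∪ ⁅ 2F ⁆ ∪ ⁅ 8F ⁆
iSet 3F = ⁅ 2F ⁆ ∪ ⁅ 6F ⁆ ∪ ⁅ 8F ⁆
iSet 4F = ⁅ 1F ⁆ ∪ ⁅ 7F ⁆ ∪ ⁅ 8F ⁆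
iSet 5F = ⁅ 5F ⁆ ∪ ⁅ 7F ⁆ ∪ ⁅ 8F ⁆
iSet 6F = ⁅ 0F ⁆ ∪ ⁅ 1F ⁆ ∪ ⁅ 4F ⁆
iSet 7F = ⁅ 0F ⁆ ∪ ⁅ 4F ⁆ ∪ ⁅ 5F ⁆
iSet 8F = ⁅ 4F ⁆ ∪ ⁅ 5F ⁆ ∪ ⁅ 6F ⁆

iSet-independentDominating : ∀ x → IndependentDominating G (iSet x)
iSet-independentDominating = from-yes (all? (independentDominating? G ∘ iSet))

∣iSet∣≡3 : ∀ x → ∣ iSet x ∣ ≡ 3
∣iSet∣≡3 = from-yes (all? λ x → ∣ iSet x ∣ ℕ.≟ 3)

independentDominating⇒3≤∣∣ : ∀ T → IndependentDominating G T → 3 ≤ ∣ T ∣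
independentDominating⇒3≤∣∣ = from-yes (allSubset? λ T →
  independentDominating? G T →-dec (3 ≤? ∣ T ∣))

independentDominating∧∣∣≡3⇒listed : ∀ T →
  IndependentDominating G T → ∣ T ∣ ≡ 3 → ∃[ x ] iSet x ≡ T
independentDominating∧∣∣≡3⇒listed = from-yes (allSubset? λ T →
  independentDominating? G T →-dec ((∣ T ∣ ℕ.≟ 3) →-dec
    any? (λ x → ≡-dec Bool._≟_ (iSet x) T)))

iSet-injective : ∀ x y → iSet x ≡ iSet y → x ≡ y
iSet-injective = from-yes (all? λ x → all? λ y →
  ≡-dec Bool._≟_ (iSet x) (iSet y) →-dec (x Fin.≟ y))

θ334-adjacent⇔iSetJump : ∀ x y →
  (Adj θ334 x y ≡ true) ⇔ ISetJump G (iSet x) (iSet y)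
θ334-adjacent⇔iSetJump = from-yes (all? λ x → all? λ y →
  (Adj θ334 x y Bool.≟ true) ⇔-dec iSetJump? G (iSet x) (iSet y))

mainTheorem18 : IsIGraph θ334
mainTheorem18 =
  G , iSet , iSet-isISet , iSet-injective , iSet-surjective , θ334-adjacent⇔iSetJump
  where
  isISet⇔ : ∀ S → IsISet G S ⇔ (IndependentDominating G S × ∣ S ∣ ≡ 3)
  isISet⇔ = isISet⇔minimumSize G
    (iSet-independentDominating 0F) (∣iSet∣≡3 0F) independentDominating⇒3≤∣∣

  iSet-isISet : ∀ x → IsISet G (iSet x)
  iSet-isISet x = Equivalence.from (isISet⇔ (iSet x))
    (iSet-independentDominating x , ∣iSet∣≡3 x)

  iSet-surjective : ∀ S → IsISet G S → ∃[ x ] iSet x ≡ S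
  iSet-surjective S isS =
    let idS , ∣S∣≡3 = Equivalence.to (isISet⇔ S) isS
    in  independentDominating∧∣∣≡3⇒listed S idS ∣S∣≡3
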